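{- Let $G$ be a bipartite graph with bipartition $\{B,R\}$, where $m:=|B|\ge 1$, $n:=|R|\ge1$ and $m\le n$, and let $k$ be an integer with $1\le k\le m+n-1$. Let $\mathcal R$ (resp. $\mathcal B$) be the set of $k$-subsets $A$ of $V(G)$ with $|R\cap A|$ odd (resp. even). Suppose $G$ has either a perfect matching or an almost perfect matching. If $G'$ is a bipartite graph on the same vertex set with the same bipartition $\{R,B\}$ that contains $G$ as a subgraph, then $\beta(F_k(G'))=\max\{|\mathcal R|,|\mathcal B|\}$.
   Context: For a simple finite graph $G$ of order $N$ and an integer $1\le k\le N-1$, the $k$-token graph $F_k(G)$ is the graph whose vertices are all $k$-element subsets of $V(G)$, two such subsets being adjacent iff their symmetric difference is an edge of $G$. $\beta$ denotes the independence number. A perfect matching covers all vertices; an almost perfect matching is a matching covering all but exactly one vertex. -}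

module Defs where

open import Data.Bool using (Bool; true; false; if_then_else_)
open import Data.Nat using (ℕ; zero; suc; _≤_; _<_; _%_; _≤ᵇ_; _≡ᵇ_; _⊔_)
open import Data.Fin using (Fin; toℕ)
open import Data.Fin.Subset using (Subset; _∩_; _∪_; _─_; ∣_∣; ⁅_⁆; inside; outside)
open import Data.Vec using (Vec; []; _∷_; tabulate)
open import Data.List using (List; []; _∷_; _++_; map; length; filterᵇ; concatMap)
open import Data.List.Relation.Unary.All using (All)
open import Data.List.Relation.Unary.Unique.Propositional using (Unique)
import Data.List.Membership.Propositional as LM
open import Data.Product using (Σ; ∃; ∃-syntax; _×_; _,_)
open import Data.Sum using (_⊎_)
open import Relation.Binary.PropositionalEquality using (_≡_; _≢_)
open import Relation.Nullary using (¬_)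

record Graph (N : ℕ) : Set where
  field
    adj   : Fin N → Fin N → Bool
    sym   : ∀ u v → adj u v ≡ adj v u
    irrefl : ∀ u → adj u u ≡ false
open Graph public

Edge : ∀ {N} → Graph N → Fin N → Fin N → Set
Edge G u v = adj G u v ≡ true

-- Vertex set Fin (m + n): B = vertices with index < m, R = vertices with index ≥ m.
InB : (m : ℕ) {N : ℕ} → Fin N → Set
InB m i = toℕ i < m

InR : (m : ℕ) {N : ℕ} → Fin N → Set
InR m i = m ≤ toℕ i

IsBipartiteWith : (m : ℕ) {N : ℕ} → Graph N → Set
IsBipartiteWith m G = ∀ u v → Edge G u v → (InB m u × InR m v) ⊎ (InR m u × InB m v)

_⊑_ : ∀ {N} → Graph N → Graph N → Set
G ⊑ G' = ∀ u v → Edge G u v → Edge G' u v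

endpoints : ∀ {N} → List (Fin N × Fin N) → List (Fin N)
endpoints [] = []
endpoints ((u , v) ∷ es) = u ∷ v ∷ endpoints es

IsMatching : ∀ {N} → Graph N → List (Fin N × Fin N) → Set
IsMatching G M = All (λ e → Edge G (Data.Product.proj₁ e) (Data.Product.proj₂ e)) M
               × Unique (endpoints M)

HasPerfectMatching : ∀ {N} → Graph N → Set
HasPerfectMatching {N} G = ∃[ M ] IsMatching G M × (∀ (x : Fin N) → x LM.∈ endpoints M)

HasAlmostPerfectMatching : ∀ {N} → Graph N → Set
HasAlmostPerfectMatching {N} G =
  ∃[ M ] IsMatching G M × (∃[ w ] (¬ (w LM.∈ endpoints M))
                                  × (∀ (x : Fin N) → x ≢ w → x LM.∈ endpoints M))

-- k-token graph F_k(G): vertices are k-subsets; A ~ A' iff A Δ A' = {u, v} with uv ∈ E(G).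
symDiff : ∀ {N} → Subset N → Subset N → Subset N
symDiff A A' = (A ─ A') ∪ (A' ─ A)

TokenAdj : ∀ {N} → Graph N → Subset N → Subset N → Set
TokenAdj G A A' = ∃[ u ] ∃[ v ] Edge G u v × symDiff A A' ≡ (⁅ u ⁆ ∪ ⁅ v ⁆)

IsIndependentTok : ∀ {N} → Graph N → ℕ → List (Subset N) → Set
IsIndependentTok G k I =
  Unique I × All (λ A → ∣ A ∣ ≡ k) I
  × (∀ {A A'} → A LM.∈ I → A' LM.∈ I → ¬ TokenAdj G A A')

IndependenceNumberTok : ∀ {N} → Graph N → ℕ → ℕ → Set
IndependenceNumberTok G k b =
  (∃[ I ] IsIndependentTok G k I × length I ≡ b)
  × (∀ I → IsIndependentTok G k I → length I ≤ b)

allSubsets : ∀ N → List (Subset N)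
allSubsets zero = [] ∷ []
allSubsets (suc N) = map (outside ∷_) (allSubsets N) ++ map (inside ∷_) (allSubsets N)

Rset : (m : ℕ) {N : ℕ} → Subset N
Rset m = tabulate (λ i → m ≤ᵇ toℕ i)

isOddᵇ : ℕ → Bool
isOddᵇ x = (x % 2) ≡ᵇ 1

countRed : (m N k : ℕ) → ℕ
countRed m N k = length (filterᵇ (λ A → (∣ A ∣ ≡ᵇ k) Data.Bool.∧ isOddᵇ ∣ Rset m ∩ A ∣) (allSubsets N))

countBlue : (m N k : ℕ) → ℕ
countBlue m N k = length (filterᵇ (λ A → (∣ A ∣ ≡ᵇ k) Data.Bool.∧ Data.Bool.not (isOddᵇ ∣ Rset m ∩ A ∣)) (allSubsets N))

-- Every edge of the bipartite graph G' changes |R ∩ A| by exactly one, so both parity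
-- classes are independent in F_k(G') and β ≥ max(|𝓡|, |𝓑|).  Conversely fix a (near-)perfect
-- matching M of G ⊆ G'.  Switching a k-set A along the first edge of M that A splits is an
-- involution which moves A to an adjacent k-set of the other parity.  The k-sets splitting no
-- edge of M all have the same parity c: such a set is a union of matched pairs, each with one
-- vertex in R, plus possibly the unmatched vertex, whose membership is fixed by the parity of k.
-- Hence switching exactly the sets of parity ≠ c maps an independent set injectively into the
-- class of parity c, as a set and its switch are adjacent.
module Submission where

open import Defs hiding (sym)
open import Data.Nat using (ℕ; _+_; _≤_; _⊔_)
open import Data.Sum using (_⊎_)

open import Data.Bool using (Bool; true; false; not; _∧_; _xor_; if_then_else_; T)
open import Data.Bool.Properties
  using (not-distribˡ-xor; xor-same; xor-identityˡ; xor-identityʳ; xor-assoc; ∧-distribˡ-xor;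
         ¬-not; T-≡; T-not-≡; T-∧)
  renaming (_≟_ to _≟ᵇ_)
open import Data.Empty using (⊥-elim)
open import Data.Fin using (Fin; zero; suc; toℕ; _≟_)
open import Data.Fin.Subset using (Subset; _∩_; _∪_; ∣_∣; ⁅_⁆; ⊤; ⊥; ⋃; inside; outside)
  renaming (_∈_ to _∈ₛ_; _∉_ to _∉ₛ_)
open import Data.Fin.Subset.Properties
  using (x∈⁅x⁆; x∈⁅y⁆⇒x≡y; x∈p∪q⁺; x∈p∪q⁻; ∉⊥; ∈⊤; ⊆⊤; ⊆-antisym; ∪-identityʳ; ∩-identityˡ;
         ∩-identityʳ; ∩-zeroʳ; ∪-identityˡ; ∣⊥∣≡0; anySubset?)
open import Data.List using (List; []; _∷_; _++_; map; length; filterᵇ; fromMaybe; [_])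
open import Data.List.Properties using (length-++; length-map)
open import Data.List.Membership.Propositional using (_∈_; _∉_)
open import Data.List.Membership.Propositional.Properties
  using (∈-map⁺; ∈-map⁻; ∈-++⁺ˡ; ∈-++⁺ʳ; ∈-++⁻; ∈-∃++; ∈-filter⁺; ∈-filter⁻)
open import Data.List.Relation.Binary.Subset.Propositional using (_⊆_)
open import Data.List.Relation.Unary.All as All using (All; []; _∷_)
open import Data.List.Relation.Unary.All.Properties as All using ()
open import Data.List.Relation.Unary.Any using (here; there)
open import Data.List.Relation.Unary.AllPairs using ([]; _∷_)
open import Data.List.Relation.Unary.Unique.Propositional using (Unique)
open import Data.List.Relation.Unary.Unique.Propositional.Properties as Unique
  using (Unique[x∷xs]⇒x∉xs)
open import Data.Maybe using (Maybe; just; nothing)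
open import Data.Nat using (zero; suc; z≤n; s≤s; _≡ᵇ_; _≤ᵇ_; ⌊_/2⌋) renaming (_≟_ to _≟ℕ_)
open import Data.Nat.Properties
  using (+-assoc; +-suc; +-identityʳ; +-cancelˡ-≡; +-cancelʳ-≡; n≡⌊n+n/2⌋; ≡ᵇ⇒≡; ≡⇒≡ᵇ;
         ≤ᵇ⇒≤; ≤⇒≤ᵇ; <⇒≱; ≤-total; ≤-trans; m≤m⊔n; m≤n⊔m; m≤n⇒m⊔n≡n; m≥n⇒m⊔n≡m)
open import Data.Nat.Tactic.RingSolver using (solve-∀)
open import Data.Product using (∃; _×_; _,_; proj₁; proj₂)
open import Data.Sum using (inj₁; inj₂; [_,_]′)
open import Data.Vec using ([]; _∷_; lookup; zipWith; here; there)
open import Data.Vec.Properties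
  using (lookup-zipWith; lookup∘tabulate; []=⇒lookup; lookup⇒[]=; ∷-injectiveʳ;
         zipWith-assoc; zipWith-identityˡ; zipWith-identityʳ; zipWith-distribˡ)
open import Function using (_∘_; case_of_)
open import Function.Bundles using (Equivalence)
open import Relation.Binary.PropositionalEquality hiding ([_])
open import Relation.Nullary using (¬_; Dec; yes; no)
open import Relation.Nullary.Decidable using (T?; _×-dec_)

private
  variable
    A B : Set
    n : ℕ

true≢false : true ≢ false
true≢false ()

bit : Bool → ℕ
bit true  = 1
bit false = 0

bit-xor : ∀ a b → a xor b ≡ true → bit a + bit b ≡ 1
bit-xor true  false _ = refl
bit-xor false true  _ = refl

xor≡true⇒not≡ : ∀ {a b} → a xor b ≡ true → not a ≡ b
xor≡true⇒not≡ {true}  {false} _ = refl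
xor≡true⇒not≡ {false} {true}  _ = refl

xor≡false⇒≡ : ∀ {a b} → a xor b ≡ false → a ≡ b
xor≡false⇒≡ {true}  {true}  _ = refl
xor≡false⇒≡ {false} {false} _ = refl

xor-trueʳ : ∀ b → b xor true ≡ not b
xor-trueʳ true  = refl
xor-trueʳ false = refl

not-xor-not : ∀ a b → not a xor not b ≡ a xor b
not-xor-not true  b     = refl
not-xor-not false true  = refl
not-xor-not false false = refl

double-injective : ∀ {m n} → m + m ≡ n + n → m ≡ n
double-injective {m} {n} eq = trans (n≡⌊n+n/2⌋ m) (trans (cong ⌊_/2⌋ eq) (sym (n≡⌊n+n/2⌋ n)))

isOddᵇ-suc : ∀ n → isOddᵇ (suc n) ≡ not (isOddᵇ n)
isOddᵇ-suc zero          = refl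
isOddᵇ-suc (suc zero)    = refl
isOddᵇ-suc (suc (suc n)) = isOddᵇ-suc n

isOddᵇ-+ : ∀ m n → isOddᵇ (m + n) ≡ isOddᵇ m xor isOddᵇ n
isOddᵇ-+ zero    n = refl
isOddᵇ-+ (suc m) n = begin
  isOddᵇ (suc (m + n))            ≡⟨ isOddᵇ-suc (m + n) ⟩
  not (isOddᵇ (m + n))            ≡⟨ cong not (isOddᵇ-+ m n) ⟩
  not (isOddᵇ m xor isOddᵇ n)     ≡⟨ not-distribˡ-xor (isOddᵇ m) (isOddᵇ n) ⟩
  not (isOddᵇ m) xor isOddᵇ n     ≡⟨ cong (_xor isOddᵇ n) (isOddᵇ-suc m) ⟨
  isOddᵇ (suc m) xor isOddᵇ n     ∎
  where open ≡-Reasoning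

isOddᵇ-+-double : ∀ m n → isOddᵇ (m + (n + n)) ≡ isOddᵇ m
isOddᵇ-+-double m n = begin
  isOddᵇ (m + (n + n))                      ≡⟨ isOddᵇ-+ m (n + n) ⟩
  isOddᵇ m xor isOddᵇ (n + n)               ≡⟨ cong (isOddᵇ m xor_) (isOddᵇ-+ n n) ⟩
  isOddᵇ m xor (isOddᵇ n xor isOddᵇ n)      ≡⟨ cong (isOddᵇ m xor_) (xor-same (isOddᵇ n)) ⟩
  isOddᵇ m xor false                        ≡⟨ xor-identityʳ (isOddᵇ m) ⟩
  isOddᵇ m                                  ∎
  where open ≡-Reasoning

-- Symmetric difference of subsets

infixr 6 _⊕_

_⊕_ : Subset n → Subset n → Subset n
_⊕_ = zipWith _xor_

⁅_⁆∪⁅_⁆ : Fin n → Fin n → Subset n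
⁅ u ⁆∪⁅ v ⁆ = ⁅ u ⁆ ∪ ⁅ v ⁆

symDiff≡⊕ : (p q : Subset n) → symDiff p q ≡ p ⊕ q
symDiff≡⊕ []           []           = refl
symDiff≡⊕ (true  ∷ p)  (true  ∷ q)  = cong (false ∷_) (symDiff≡⊕ p q)
symDiff≡⊕ (true  ∷ p)  (false ∷ q)  = cong (true ∷_)  (symDiff≡⊕ p q)
symDiff≡⊕ (false ∷ p)  (true  ∷ q)  = cong (true ∷_)  (symDiff≡⊕ p q)
symDiff≡⊕ (false ∷ p)  (false ∷ q)  = cong (false ∷_) (symDiff≡⊕ p q)

lookup-⊕ : ∀ (p q : Subset n) x → lookup (p ⊕ q) x ≡ lookup p x xor lookup q x
lookup-⊕ p q x = lookup-zipWith _xor_ x p q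

⊕-self : (p : Subset n) → p ⊕ p ≡ ⊥
⊕-self []      = refl
⊕-self (b ∷ p) = cong₂ _∷_ (xor-same b) (⊕-self p)

⊕-cancelˡ : (p q : Subset n) → p ⊕ p ⊕ q ≡ q
⊕-cancelˡ p q = begin
  p ⊕ p ⊕ q     ≡⟨ zipWith-assoc xor-assoc p p q ⟨
  (p ⊕ p) ⊕ q   ≡⟨ cong (_⊕ q) (⊕-self p) ⟩
  ⊥ ⊕ q         ≡⟨ zipWith-identityˡ xor-identityˡ q ⟩
  q             ∎
  where open ≡-Reasoning

⊕-cancelʳ : (p q : Subset n) → (p ⊕ q) ⊕ q ≡ p
⊕-cancelʳ p q = begin
  (p ⊕ q) ⊕ q   ≡⟨ zipWith-assoc xor-assoc p q q ⟩
  p ⊕ q ⊕ q     ≡⟨ cong (p ⊕_) (⊕-self q) ⟩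
  p ⊕ ⊥         ≡⟨ zipWith-identityʳ xor-identityʳ p ⟩
  p             ∎
  where open ≡-Reasoning

∩-distribˡ-⊕ : (r p q : Subset n) → r ∩ (p ⊕ q) ≡ (r ∩ p) ⊕ (r ∩ q)
∩-distribˡ-⊕ = zipWith-distribˡ ∧-distribˡ-xor

∣∷∣ : ∀ b (p : Subset n) → ∣ b ∷ p ∣ ≡ bit b + ∣ p ∣
∣∷∣ true  p = refl
∣∷∣ false p = refl

∣⊕∣+2∣∩∣ : (p q : Subset n) → ∣ p ⊕ q ∣ + (∣ p ∩ q ∣ + ∣ p ∩ q ∣) ≡ ∣ p ∣ + ∣ q ∣
∣⊕∣+2∣∩∣ []          []          = refl
∣⊕∣+2∣∩∣ (true  ∷ p) (true  ∷ q) =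
  trans (shift ∣ p ⊕ q ∣ ∣ p ∩ q ∣)
        (trans (cong (λ s → suc (suc s)) (∣⊕∣+2∣∩∣ p q)) (sym (+-suc (suc ∣ p ∣) ∣ q ∣)))
  where shift : ∀ x t → x + (suc t + suc t) ≡ suc (suc (x + (t + t)))
        shift = solve-∀
∣⊕∣+2∣∩∣ (true  ∷ p) (false ∷ q) = cong suc (∣⊕∣+2∣∩∣ p q)
∣⊕∣+2∣∩∣ (false ∷ p) (true  ∷ q) = trans (cong suc (∣⊕∣+2∣∩∣ p q)) (sym (+-suc ∣ p ∣ ∣ q ∣))
∣⊕∣+2∣∩∣ (false ∷ p) (false ∷ q) = ∣⊕∣+2∣∩∣ p q

isOddᵇ-∣⊕∣ : (p q : Subset n) → isOddᵇ ∣ p ⊕ q ∣ ≡ isOddᵇ ∣ p ∣ xor isOddᵇ ∣ q ∣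
isOddᵇ-∣⊕∣ p q = begin
  isOddᵇ ∣ p ⊕ q ∣                                  ≡⟨ isOddᵇ-+-double ∣ p ⊕ q ∣ ∣ p ∩ q ∣ ⟨
  isOddᵇ (∣ p ⊕ q ∣ + (∣ p ∩ q ∣ + ∣ p ∩ q ∣))      ≡⟨ cong isOddᵇ (∣⊕∣+2∣∩∣ p q) ⟩
  isOddᵇ (∣ p ∣ + ∣ q ∣)                            ≡⟨ isOddᵇ-+ ∣ p ∣ ∣ q ∣ ⟩
  isOddᵇ ∣ p ∣ xor isOddᵇ ∣ q ∣                     ∎
  where open ≡-Reasoning

countIn : List (Fin n) → Subset n → ℕ
countIn []       p = 0
countIn (x ∷ xs) p = bit (lookup p x) + countIn xs p

countIn-++ : ∀ xs ys (p : Subset n) → countIn (xs ++ ys) p ≡ countIn xs p + countIn ys p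
countIn-++ []       ys p = refl
countIn-++ (x ∷ xs) ys p =
  trans (cong (bit (lookup p x) +_) (countIn-++ xs ys p)) (sym (+-assoc (bit (lookup p x)) _ _))

AgreeOn : List (Fin n) → Subset n → Subset n → Set
AgreeOn xs p q = All (λ x → lookup p x ≡ lookup q x) xs

countIn-cong : ∀ {xs : List (Fin n)} {p q} → AgreeOn xs p q → countIn xs p ≡ countIn xs q
countIn-cong []       = refl
countIn-cong (e ∷ es) = cong₂ _+_ (cong bit e) (countIn-cong es)

AgreeOn-∩ˡ : ∀ (r : Subset n) {xs p q} → AgreeOn xs p q → AgreeOn xs (r ∩ p) (r ∩ q)
AgreeOn-∩ˡ r {p = p} {q} = All.map λ {x} e →
  trans (lookup-zipWith _∧_ x r p) (trans (cong (lookup r x ∧_) e) (sym (lookup-zipWith _∧_ x r q)))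

toSubset : List (Fin n) → Subset n
toSubset xs = ⋃ (map ⁅_⁆ xs)

∈-toSubset⁺ : ∀ {x : Fin n} {xs} → x ∈ xs → x ∈ₛ toSubset xs
∈-toSubset⁺ (here refl) = x∈p∪q⁺ (inj₁ (x∈⁅x⁆ _))
∈-toSubset⁺ (there x∈) = x∈p∪q⁺ (inj₂ (∈-toSubset⁺ x∈))

∉-toSubset⁺ : ∀ {x : Fin n} {xs} → x ∉ xs → x ∉ₛ toSubset xs
∉-toSubset⁺ {xs = []}     x∉ = ∉⊥
∉-toSubset⁺ {xs = y ∷ xs} x∉ x∈ with x∈p∪q⁻ ⁅ y ⁆ (toSubset xs) x∈
... | inj₁ x∈⁅y⁆ = x∉ (here (x∈⁅y⁆⇒x≡y y x∈⁅y⁆))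
... | inj₂ x∈xs  = ∉-toSubset⁺ (λ x∈ → x∉ (there x∈)) x∈xs

∣p∩[⁅x⁆∪q]∣ : ∀ (p q : Subset n) x → x ∉ₛ q → ∣ p ∩ (⁅ x ⁆ ∪ q) ∣ ≡ bit (lookup p x) + ∣ p ∩ q ∣
∣p∩[⁅x⁆∪q]∣ (a     ∷ p) (true  ∷ q) zero x∉ = ⊥-elim (x∉ here)
∣p∩[⁅x⁆∪q]∣ (true  ∷ p) (false ∷ q) zero _  = cong (λ s → suc ∣ p ∩ s ∣) (∪-identityˡ q)
∣p∩[⁅x⁆∪q]∣ (false ∷ p) (false ∷ q) zero _  = cong (λ s → ∣ p ∩ s ∣) (∪-identityˡ q)
∣p∩[⁅x⁆∪q]∣ (a     ∷ p) (b     ∷ q) (suc x) x∉ = begin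
  ∣ (a ∧ b) ∷ p ∩ (⁅ x ⁆ ∪ q) ∣                ≡⟨ ∣∷∣ (a ∧ b) (p ∩ (⁅ x ⁆ ∪ q)) ⟩
  bit (a ∧ b) + ∣ p ∩ (⁅ x ⁆ ∪ q) ∣
    ≡⟨ cong (bit (a ∧ b) +_) (∣p∩[⁅x⁆∪q]∣ p q x (x∉ ∘ there)) ⟩
  bit (a ∧ b) + (bit (lookup p x) + ∣ p ∩ q ∣)  ≡⟨ swap (bit (a ∧ b)) (bit (lookup p x)) _ ⟩
  bit (lookup p x) + (bit (a ∧ b) + ∣ p ∩ q ∣)  ≡⟨ cong (bit (lookup p x) +_) (∣∷∣ (a ∧ b) (p ∩ q)) ⟨
  bit (lookup p x) + ∣ (a ∧ b) ∷ p ∩ q ∣        ∎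
  where open ≡-Reasoning
        swap : ∀ i j k → i + (j + k) ≡ j + (i + k)
        swap = solve-∀

countIn≡∣∩toSubset∣ : ∀ {xs} (p : Subset n) → Unique xs → countIn xs p ≡ ∣ p ∩ toSubset xs ∣
countIn≡∣∩toSubset∣ {n = n} {xs = []} p _ = sym (trans (cong ∣_∣ (∩-zeroʳ p)) (∣⊥∣≡0 n))
countIn≡∣∩toSubset∣ {xs = x ∷ xs} p u@(_ ∷ u′) =
  trans (cong (bit (lookup p x) +_) (countIn≡∣∩toSubset∣ p u′))
        (sym (∣p∩[⁅x⁆∪q]∣ p (toSubset xs) x (∉-toSubset⁺ (Unique[x∷xs]⇒x∉xs u))))

countIn-complete : ∀ {xs} (p : Subset n) → Unique xs → (∀ x → x ∈ xs) → countIn xs p ≡ ∣ p ∣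
countIn-complete {xs = xs} p u complete = begin
  countIn xs p            ≡⟨ countIn≡∣∩toSubset∣ p u ⟩
  ∣ p ∩ toSubset xs ∣     ≡⟨ cong (λ s → ∣ p ∩ s ∣) toSubset≡⊤ ⟩
  ∣ p ∩ ⊤ ∣               ≡⟨ cong ∣_∣ (∩-identityʳ p) ⟩
  ∣ p ∣                   ∎
  where open ≡-Reasoning
        toSubset≡⊤ : toSubset xs ≡ ⊤
        toSubset≡⊤ = ⊆-antisym ⊆⊤ (λ {x} _ → ∈-toSubset⁺ (complete x))

∣p∩⁅u⁆∪⁅v⁆∣ : ∀ (p : Subset n) {u v} → u ≢ v →
  ∣ p ∩ ⁅ u ⁆∪⁅ v ⁆ ∣ ≡ bit (lookup p u) + bit (lookup p v)
∣p∩⁅u⁆∪⁅v⁆∣ p {u} {v} u≢v = begin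
  ∣ p ∩ ⁅ u ⁆∪⁅ v ⁆ ∣                         ≡⟨ cong (λ s → ∣ p ∩ (⁅ u ⁆ ∪ s) ∣) (∪-identityʳ ⁅ v ⁆) ⟨
  ∣ p ∩ toSubset (u ∷ v ∷ []) ∣               ≡⟨ countIn≡∣∩toSubset∣ p ((u≢v ∷ []) ∷ [] ∷ []) ⟨
  bit (lookup p u) + (bit (lookup p v) + 0)   ≡⟨ cong (bit (lookup p u) +_) (+-identityʳ _) ⟩
  bit (lookup p u) + bit (lookup p v)         ∎
  where open ≡-Reasoning

∣⁅u⁆∪⁅v⁆∣ : ∀ {u v : Fin n} → u ≢ v → ∣ ⁅ u ⁆∪⁅ v ⁆ ∣ ≡ 2
∣⁅u⁆∪⁅v⁆∣ {u = u} {v = v} u≢v = begin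
  ∣ ⁅ u ⁆∪⁅ v ⁆ ∣                        ≡⟨ cong ∣_∣ (∩-identityˡ ⁅ u ⁆∪⁅ v ⁆) ⟨
  ∣ ⊤ ∩ ⁅ u ⁆∪⁅ v ⁆ ∣                    ≡⟨ ∣p∩⁅u⁆∪⁅v⁆∣ ⊤ u≢v ⟩
  bit (lookup ⊤ u) + bit (lookup ⊤ v)    ≡⟨ cong₂ (λ a b → bit a + bit b) (lookup-⊤ u) (lookup-⊤ v) ⟩
  2                                      ∎
  where open ≡-Reasoning
        lookup-⊤ : ∀ x → lookup ⊤ x ≡ true
        lookup-⊤ x = []=⇒lookup (∈⊤ {x = x})

∣p⊕⁅u⁆∪⁅v⁆∣ : ∀ (p : Subset n) {u v} → u ≢ v → lookup p u xor lookup p v ≡ true →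
  ∣ p ⊕ ⁅ u ⁆∪⁅ v ⁆ ∣ ≡ ∣ p ∣
∣p⊕⁅u⁆∪⁅v⁆∣ p {u} {v} u≢v split = +-cancelʳ-≡ 2 _ _ (begin
  ∣ p ⊕ ⁅ u ⁆∪⁅ v ⁆ ∣ + 2
    ≡⟨ cong (λ t → ∣ p ⊕ ⁅ u ⁆∪⁅ v ⁆ ∣ + (t + t)) one ⟨
  ∣ p ⊕ ⁅ u ⁆∪⁅ v ⁆ ∣ + (∣ p ∩ ⁅ u ⁆∪⁅ v ⁆ ∣ + ∣ p ∩ ⁅ u ⁆∪⁅ v ⁆ ∣)
    ≡⟨ ∣⊕∣+2∣∩∣ p ⁅ u ⁆∪⁅ v ⁆ ⟩
  ∣ p ∣ + ∣ ⁅ u ⁆∪⁅ v ⁆ ∣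
    ≡⟨ cong (∣ p ∣ +_) (∣⁅u⁆∪⁅v⁆∣ u≢v) ⟩
  ∣ p ∣ + 2 ∎)
  where open ≡-Reasoning
        one : ∣ p ∩ ⁅ u ⁆∪⁅ v ⁆ ∣ ≡ 1
        one = trans (∣p∩⁅u⁆∪⁅v⁆∣ p u≢v) (bit-xor (lookup p u) (lookup p v) split)

module _ {p : Subset n} {u v : Fin n} where

  lookup-⊕⁅u⁆∪⁅v⁆-≢ : ∀ {x} → x ≢ u → x ≢ v → lookup (p ⊕ ⁅ u ⁆∪⁅ v ⁆) x ≡ lookup p x
  lookup-⊕⁅u⁆∪⁅v⁆-≢ {x} x≢u x≢v = begin
    lookup (p ⊕ ⁅ u ⁆∪⁅ v ⁆) x          ≡⟨ lookup-⊕ p ⁅ u ⁆∪⁅ v ⁆ x ⟩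
    lookup p x xor lookup ⁅ u ⁆∪⁅ v ⁆ x ≡⟨ cong (lookup p x xor_) (¬-not (x∉ ∘ lookup⇒[]= x _)) ⟩
    lookup p x xor false              ≡⟨ xor-identityʳ (lookup p x) ⟩
    lookup p x                        ∎
    where open ≡-Reasoning
          x∉ : x ∉ₛ ⁅ u ⁆∪⁅ v ⁆
          x∉ x∈ with x∈p∪q⁻ ⁅ u ⁆ ⁅ v ⁆ x∈
          ... | inj₁ x∈⁅u⁆ = x≢u (x∈⁅y⁆⇒x≡y u x∈⁅u⁆)
          ... | inj₂ x∈⁅v⁆ = x≢v (x∈⁅y⁆⇒x≡y v x∈⁅v⁆)

  lookup-⊕⁅u⁆∪⁅v⁆-∈ : ∀ {x} → x ∈ₛ ⁅ u ⁆∪⁅ v ⁆ → lookup (p ⊕ ⁅ u ⁆∪⁅ v ⁆) x ≡ not (lookup p x)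
  lookup-⊕⁅u⁆∪⁅v⁆-∈ {x} x∈ =
    trans (lookup-⊕ p ⁅ u ⁆∪⁅ v ⁆ x) (trans (cong (lookup p x xor_) ([]=⇒lookup x∈)) (xor-trueʳ _))

  xor-⊕⁅u⁆∪⁅v⁆ : lookup (p ⊕ ⁅ u ⁆∪⁅ v ⁆) u xor lookup (p ⊕ ⁅ u ⁆∪⁅ v ⁆) v
               ≡ lookup p u xor lookup p v
  xor-⊕⁅u⁆∪⁅v⁆ = begin
    lookup (p ⊕ ⁅ u ⁆∪⁅ v ⁆) u xor lookup (p ⊕ ⁅ u ⁆∪⁅ v ⁆) v
      ≡⟨ cong₂ _xor_ (lookup-⊕⁅u⁆∪⁅v⁆-∈ (x∈p∪q⁺ (inj₁ (x∈⁅x⁆ u))))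
                     (lookup-⊕⁅u⁆∪⁅v⁆-∈ (x∈p∪q⁺ (inj₂ (x∈⁅x⁆ v)))) ⟩
    not (lookup p u) xor not (lookup p v)
      ≡⟨ not-xor-not (lookup p u) (lookup p v) ⟩
    lookup p u xor lookup p v ∎
    where open ≡-Reasoning

Unique-++⁻ʳ : (xs : List A) → ∀ {ys} → Unique (xs ++ ys) → Unique ys
Unique-++⁻ʳ []       u       = u
Unique-++⁻ʳ (x ∷ xs) (_ ∷ u) = Unique-++⁻ʳ xs u

Unique-⊆⇒length≤ : {xs ys : List A} → Unique xs → xs ⊆ ys → length xs ≤ length ys
Unique-⊆⇒length≤ {xs = []}     _         _  = z≤n
Unique-⊆⇒length≤ {xs = x ∷ xs} (x∉ ∷ u) xs⊆ys with ∈-∃++ (xs⊆ys (here refl))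
... | us , zs , refl = subst (_ ≤_) (sym length-us++x∷zs) (s≤s (Unique-⊆⇒length≤ u xs⊆us++zs))
  where
  length-us++x∷zs : length (us ++ [ x ] ++ zs) ≡ suc (length (us ++ zs))
  length-us++x∷zs =
    trans (length-++ us) (trans (+-suc (length us) (length zs)) (cong suc (sym (length-++ us))))
  xs⊆us++zs : xs ⊆ us ++ zs
  xs⊆us++zs y∈xs with ∈-++⁻ us (xs⊆ys (there y∈xs))
  ... | inj₁ y∈us         = ∈-++⁺ˡ y∈us
  ... | inj₂ (here refl)  = ⊥-elim (All.lookup x∉ y∈xs refl)
  ... | inj₂ (there y∈zs) = ∈-++⁺ʳ us y∈zs

injectiveOn⇒Unique-map : (f : A → B) {xs : List A} →
  (∀ {x y} → x ∈ xs → y ∈ xs → f x ≡ f y → x ≡ y) → Unique xs → Unique (map f xs)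
injectiveOn⇒Unique-map f {[]}     inj []       = []
injectiveOn⇒Unique-map f {x ∷ xs} inj (x∉ ∷ u) =
  All.map⁺ (All.tabulate (λ y∈ fx≡fy → All.lookup x∉ y∈ (inj (here refl) (there y∈) fx≡fy)))
  ∷ injectiveOn⇒Unique-map f (λ x∈ y∈ → inj (there x∈) (there y∈)) u

injectiveOn⇒length≤ : (f : A → B) {xs : List A} {ys : List B} → Unique xs →
  (∀ {x y} → x ∈ xs → y ∈ xs → f x ≡ f y → x ≡ y) → (∀ {x} → x ∈ xs → f x ∈ ys) →
  length xs ≤ length ys
injectiveOn⇒length≤ f {xs} u inj into = subst (_≤ _) (length-map f xs)
  (Unique-⊆⇒length≤ (injectiveOn⇒Unique-map f inj u) λ y∈ →
    case ∈-map⁻ f y∈ of λ { (x , x∈ , refl) → into x∈ })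

∈-allSubsets : (p : Subset n) → p ∈ allSubsets n
∈-allSubsets []          = here refl
∈-allSubsets (false ∷ p) = ∈-++⁺ˡ (∈-map⁺ (outside ∷_) (∈-allSubsets p))
∈-allSubsets {n = suc n} (true ∷ p) =
  ∈-++⁺ʳ (map (outside ∷_) (allSubsets n)) (∈-map⁺ (inside ∷_) (∈-allSubsets p))

allSubsets-unique : ∀ n → Unique (allSubsets n)
allSubsets-unique zero    = [] ∷ []
allSubsets-unique (suc n) = Unique.++⁺ (Unique.map⁺ ∷-injectiveʳ (allSubsets-unique n))
                                       (Unique.map⁺ ∷-injectiveʳ (allSubsets-unique n)) disjoint
  where
  disjoint : ∀ {p} → ¬ (p ∈ map (outside ∷_) (allSubsets n) × p ∈ map (inside ∷_) (allSubsets n))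
  disjoint (p∈out , p∈in) with ∈-map⁻ (outside ∷_) p∈out | ∈-map⁻ (inside ∷_) p∈in
  ... | _ , _ , refl | _ , _ , ()

edge⇒≢ : (H : Graph n) → ∀ {u v} → Edge H u v → u ≢ v
edge⇒≢ H {u} uv refl = true≢false (trans (sym uv) (irrefl H u))

lookup-Rset : ∀ m (x : Fin n) → lookup (Rset m) x ≡ (m ≤ᵇ toℕ x)
lookup-Rset m x = lookup∘tabulate (λ i → m ≤ᵇ toℕ i) x

InB⇒∉Rset : ∀ m {x : Fin n} → InB m x → lookup (Rset m) x ≡ false
InB⇒∉Rset m {x} x<m =
  trans (lookup-Rset m x) (¬-not (λ m≤x → <⇒≱ x<m (≤ᵇ⇒≤ m (toℕ x) (Equivalence.from T-≡ m≤x))))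

InR⇒∈Rset : ∀ m {x : Fin n} → InR m x → lookup (Rset m) x ≡ true
InR⇒∈Rset m {x} m≤x = trans (lookup-Rset m x) (Equivalence.to T-≡ (≤⇒≤ᵇ m≤x))

bipartite⇒xor-Rset : ∀ {m} {H : Graph n} → IsBipartiteWith m H →
  ∀ {u v} → Edge H u v → lookup (Rset m) u xor lookup (Rset m) v ≡ true
bipartite⇒xor-Rset {m = m} bipartite {u} {v} uv with bipartite u v uv
... | inj₁ (u∈B , v∈R) rewrite InB⇒∉Rset m u∈B | InR⇒∈Rset m v∈R = refl
... | inj₂ (u∈R , v∈B) rewrite InR⇒∈Rset m u∈R | InB⇒∉Rset m v∈B = refl

-- Switching a subset along a matching

splitPair : List (Fin n × Fin n) → Subset n → Maybe (Fin n × Fin n)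
splitPair []            p = nothing
splitPair ((u , v) ∷ M) p = if lookup p u xor lookup p v then just (u , v) else splitPair M p

toggle : Subset n → Maybe (Fin n × Fin n) → Subset n
toggle p nothing        = p
toggle p (just (u , v)) = p ⊕ ⁅ u ⁆∪⁅ v ⁆

switch : List (Fin n × Fin n) → Subset n → Subset n
switch M p = toggle p (splitPair M p)

Unsplit : List (Fin n × Fin n) → Subset n → Set
Unsplit M p = All (λ e → lookup p (proj₁ e) ≡ lookup p (proj₂ e)) M

Unsplit? : (M : List (Fin n × Fin n)) (p : Subset n) → Dec (Unsplit M p)
Unsplit? M p = All.all? (λ e → lookup p (proj₁ e) ≟ᵇ lookup p (proj₂ e)) M

∈-endpoints : ∀ {M : List (Fin n × Fin n)} {u v} → (u , v) ∈ M → u ∈ endpoints M × v ∈ endpoints M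
∈-endpoints (here refl) = here refl , there (here refl)
∈-endpoints {M = _ ∷ M} (there uv∈) =
  let (u∈ , v∈) = ∈-endpoints {M = M} uv∈ in there (there u∈) , there (there v∈)

splitPair-sound : ∀ M (p : Subset n) {u v} → splitPair M p ≡ just (u , v) →
  (u , v) ∈ M × lookup p u xor lookup p v ≡ true
splitPair-sound ((a , b) ∷ M) p eq with lookup p a xor lookup p b in split
splitPair-sound ((a , b) ∷ M) p refl | true = here refl , split
... | false = let (uv∈ , split′) = splitPair-sound M p eq in there uv∈ , split′

splitPair≡nothing⇒Unsplit : ∀ M (p : Subset n) → splitPair M p ≡ nothing → Unsplit M p
splitPair≡nothing⇒Unsplit []            p _  = []
splitPair≡nothing⇒Unsplit ((a , b) ∷ M) p eq with lookup p a xor lookup p b in split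
... | false = xor≡false⇒≡ split ∷ splitPair≡nothing⇒Unsplit M p eq

splitPair-switched : ∀ M (p : Subset n) {u v} → Unique (endpoints M) →
  splitPair M p ≡ just (u , v) → splitPair M (p ⊕ ⁅ u ⁆∪⁅ v ⁆) ≡ just (u , v)
splitPair-switched ((a , b) ∷ M) p _ eq with lookup p a xor lookup p b in split
splitPair-switched ((a , b) ∷ M) p _ refl | true
  rewrite xor-⊕⁅u⁆∪⁅v⁆ {p = p} {a} {b} | split = refl
splitPair-switched ((a , b) ∷ M) p {u} {v} (a∉ ∷ b∉ ∷ unique) eq | false
  with ∈-endpoints (proj₁ (splitPair-sound M p eq))
... | u∈ , v∈
  rewrite lookup-⊕⁅u⁆∪⁅v⁆-≢ {p = p} (All.lookup a∉ (there u∈)) (All.lookup a∉ (there v∈))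
        | lookup-⊕⁅u⁆∪⁅v⁆-≢ {p = p} (All.lookup b∉ u∈) (All.lookup b∉ v∈)
        | split
  = splitPair-switched M p unique eq

switch-just : ∀ M (p : Subset n) {u v} → splitPair M p ≡ just (u , v) →
  switch M p ≡ p ⊕ ⁅ u ⁆∪⁅ v ⁆
switch-just M p eq = cong (toggle p) eq

switch-involutive : ∀ M (p : Subset n) → Unique (endpoints M) → switch M (switch M p) ≡ p
switch-involutive M p unique with splitPair M p in eq
... | nothing rewrite eq = refl
... | just (u , v) rewrite splitPair-switched M p unique eq = ⊕-cancelʳ p ⁅ u ⁆∪⁅ v ⁆

module _ (H : Graph n) {M : List (Fin n × Fin n)}
         (edges : All (λ e → Edge H (proj₁ e) (proj₂ e)) M) where

  splitPair⇒adjacent : ∀ p {u v} → splitPair M p ≡ just (u , v) → TokenAdj H p (switch M p)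
  splitPair⇒adjacent p {u} {v} eq =
    u , v , All.lookup edges (proj₁ (splitPair-sound M p eq)) , (begin
      symDiff p (switch M p)  ≡⟨ symDiff≡⊕ p (switch M p) ⟩
      p ⊕ switch M p          ≡⟨ cong (p ⊕_) (switch-just M p eq) ⟩
      p ⊕ p ⊕ ⁅ u ⁆∪⁅ v ⁆      ≡⟨ ⊕-cancelˡ p ⁅ u ⁆∪⁅ v ⁆ ⟩
      ⁅ u ⁆ ∪ ⁅ v ⁆            ∎)
    where open ≡-Reasoning

  splitPair⇒∣switch∣ : ∀ p {u v} → splitPair M p ≡ just (u , v) → ∣ switch M p ∣ ≡ ∣ p ∣
  splitPair⇒∣switch∣ p eq =
    let (uv∈ , split) = splitPair-sound M p eq
    in trans (cong ∣_∣ (switch-just M p eq))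
             (∣p⊕⁅u⁆∪⁅v⁆∣ p (edge⇒≢ H (All.lookup edges uv∈)) split)

-- Near-perfect matchings

record NearPerfectMatching (H : Graph n) : Set where
  field
    pairs             : List (Fin n × Fin n)
    unmatched         : Maybe (Fin n)
    pairs⊆edges       : All (λ e → Edge H (proj₁ e) (proj₂ e)) pairs
    vertices-unique   : Unique (fromMaybe unmatched ++ endpoints pairs)
    vertices-complete : ∀ x → x ∈ fromMaybe unmatched ++ endpoints pairs

  endpoints-unique : Unique (endpoints pairs)
  endpoints-unique = Unique-++⁻ʳ (fromMaybe unmatched) vertices-unique

perfect⇒nearPerfect : {H : Graph n} → HasPerfectMatching H → NearPerfectMatching H
perfect⇒nearPerfect (M , (edges , unique) , complete) = record
  { pairs = M ; unmatched = nothing ; pairs⊆edges = edges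
  ; vertices-unique = unique ; vertices-complete = complete }

almostPerfect⇒nearPerfect : {H : Graph n} → HasAlmostPerfectMatching H → NearPerfectMatching H
almostPerfect⇒nearPerfect (M , (edges , unique) , w , w∉ , complete) = record
  { pairs = M ; unmatched = just w ; pairs⊆edges = edges
  ; vertices-unique = All.tabulate (λ x∈ w≡x → w∉ (subst (_∈ endpoints M) (sym w≡x) x∈)) ∷ unique
  ; vertices-complete = λ x → case x ≟ w of λ where
      (yes refl) → here refl
      (no x≢w)   → there (complete x x≢w) }

NearPerfectMatching-mono : {G H : Graph n} → G ⊑ H → NearPerfectMatching G → NearPerfectMatching H
NearPerfectMatching-mono G⊑H P = record
  { pairs = pairs ; unmatched = unmatched
  ; pairs⊆edges = All.map (λ {e} → G⊑H (proj₁ e) (proj₂ e)) pairs⊆edges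
  ; vertices-unique = vertices-unique ; vertices-complete = vertices-complete }
  where open NearPerfectMatching P

countIn-endpoints : ∀ M (p : Subset n) → Unsplit M p →
  countIn (endpoints M) p ≡ countIn (map proj₁ M) p + countIn (map proj₁ M) p
countIn-endpoints []            p []                 = refl
countIn-endpoints ((a , b) ∷ M) p (pa≡pb ∷ unsplit)
  rewrite sym pa≡pb | countIn-endpoints M p unsplit =
    regroup (bit (lookup p a)) (countIn (map proj₁ M) p)
  where regroup : ∀ x s → x + (x + (s + s)) ≡ (x + s) + (x + s)
        regroup = solve-∀

AgreeOn-fromMaybe : ∀ (w : Maybe (Fin n)) {p q} →
  isOddᵇ (countIn (fromMaybe w) p) ≡ isOddᵇ (countIn (fromMaybe w) q) → AgreeOn (fromMaybe w) p q
AgreeOn-fromMaybe nothing  _ = []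
AgreeOn-fromMaybe (just w) {p} {q} eq =
  trans (sym (isOddᵇ-bit (lookup p w))) (trans eq (isOddᵇ-bit (lookup q w))) ∷ []
  where isOddᵇ-bit : ∀ b → isOddᵇ (bit b + 0) ≡ b
        isOddᵇ-bit true  = refl
        isOddᵇ-bit false = refl

-- Colouring subsets by the parity of their intersection with R

module Colouring {n : ℕ} (R : Subset n) where

  colour : Subset n → Bool
  colour p = isOddᵇ ∣ R ∩ p ∣

  Crossing : Fin n → Fin n → Set
  Crossing u v = lookup R u xor lookup R v ≡ true

  colour-⊕ : ∀ p q → colour (p ⊕ q) ≡ colour p xor colour q
  colour-⊕ p q = trans (cong (λ s → isOddᵇ ∣ s ∣) (∩-distribˡ-⊕ R p q)) (isOddᵇ-∣⊕∣ (R ∩ p) (R ∩ q))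

  colour-⁅u⁆∪⁅v⁆ : ∀ {u v} → u ≢ v → Crossing u v → colour ⁅ u ⁆∪⁅ v ⁆ ≡ true
  colour-⁅u⁆∪⁅v⁆ {u} {v} u≢v crossing =
    cong isOddᵇ (trans (∣p∩⁅u⁆∪⁅v⁆∣ R u≢v) (bit-xor (lookup R u) (lookup R v) crossing))

  countIn-endpoints-∩ : ∀ M p → All (λ e → Crossing (proj₁ e) (proj₂ e)) M → Unsplit M p →
    countIn (endpoints M) (R ∩ p) ≡ countIn (map proj₁ M) p
  countIn-endpoints-∩ []            p []                 []                 = refl
  countIn-endpoints-∩ ((a , b) ∷ M) p (crossing ∷ crosses) (pa≡pb ∷ unsplit)
    rewrite lookup-zipWith _∧_ a R p | lookup-zipWith _∧_ b R p | sym pa≡pb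
          | countIn-endpoints-∩ M p crosses unsplit
    = trans (sym (+-assoc (bit (lookup R a ∧ lookup p a)) _ _))
            (cong (_+ countIn (map proj₁ M) p)
                  (bit-∧ (lookup R a) (lookup R b) (lookup p a) crossing))
    where bit-∧ : ∀ r r′ x → r xor r′ ≡ true → bit (r ∧ x) + bit (r′ ∧ x) ≡ bit x
          bit-∧ true  false true  _ = refl
          bit-∧ true  false false _ = refl
          bit-∧ false true  true  _ = refl
          bit-∧ false true  false _ = refl

  -- colourClass k true and colourClass k false are the paper's 𝓡 and 𝓑; their lengths are
  -- definitionally countRed and countBlue when R = Rset m.
  module _ (k : ℕ) where

    inClass : Bool → Subset n → Bool
    inClass true  p = (∣ p ∣ ≡ᵇ k) ∧ colour p
    inClass false p = (∣ p ∣ ≡ᵇ k) ∧ not (colour p)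

    colourClass : Bool → List (Subset n)
    colourClass c = filterᵇ (inClass c) (allSubsets n)

    ∈-colourClass⁻ : ∀ {c p} → p ∈ colourClass c → ∣ p ∣ ≡ k × colour p ≡ c
    ∈-colourClass⁻ {c} {p} p∈ =
      inClass⁻ c (proj₂ (∈-filter⁻ (T? ∘ inClass c) {xs = allSubsets n} p∈))
      where
      inClass⁻ : ∀ c → T (inClass c p) → ∣ p ∣ ≡ k × colour p ≡ c
      inClass⁻ true  t = let (size , col) = Equivalence.to T-∧ t in
        ≡ᵇ⇒≡ _ _ size , Equivalence.to T-≡ col
      inClass⁻ false t = let (size , col) = Equivalence.to T-∧ t in
        ≡ᵇ⇒≡ _ _ size , Equivalence.to T-not-≡ col

    ∈-colourClass⁺ : ∀ {c p} → ∣ p ∣ ≡ k → colour p ≡ c → p ∈ colourClass c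
    ∈-colourClass⁺ {c} {p} size col = ∈-filter⁺ (T? ∘ inClass c) (∈-allSubsets p) (inClass⁺ c col)
      where
      inClass⁺ : ∀ c → colour p ≡ c → T (inClass c p)
      inClass⁺ true  col = Equivalence.from T-∧ (≡⇒≡ᵇ _ _ size , Equivalence.from T-≡ col)
      inClass⁺ false col = Equivalence.from T-∧ (≡⇒≡ᵇ _ _ size , Equivalence.from T-not-≡ col)

  module _ (H : Graph n) (crossing : ∀ {u v} → Edge H u v → Crossing u v) where

    adjacent⇒colour-differs : ∀ {p q} → TokenAdj H p q → colour p xor colour q ≡ true
    adjacent⇒colour-differs {p} {q} (u , v , uv , p∆q) = begin
      colour p xor colour q  ≡⟨ colour-⊕ p q ⟨
      colour (p ⊕ q)         ≡⟨ cong colour (trans (sym (symDiff≡⊕ p q)) p∆q) ⟩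
      colour ⁅ u ⁆∪⁅ v ⁆      ≡⟨ colour-⁅u⁆∪⁅v⁆ (edge⇒≢ H uv) (crossing uv) ⟩
      true                   ∎
      where open ≡-Reasoning

    colourClass-independent : ∀ k c → IsIndependentTok H k (colourClass k c)
    colourClass-independent k c =
      Unique.filter⁺ (T? ∘ inClass k c) (allSubsets-unique n) ,
      All.tabulate (λ p∈ → proj₁ (∈-colourClass⁻ k {c} p∈)) ,
      λ p∈ q∈ adj → true≢false (begin
        true                   ≡⟨ adjacent⇒colour-differs adj ⟨
        colour _ xor colour _  ≡⟨ cong₂ _xor_ (colour-∈ p∈) (colour-∈ q∈) ⟩
        c xor c                ≡⟨ xor-same c ⟩
        false                  ∎)
      where open ≡-Reasoning
            colour-∈ : ∀ {p} → p ∈ colourClass k c → colour p ≡ c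
            colour-∈ p∈ = proj₂ (∈-colourClass⁻ k p∈)

    independenceNumber≡max : ∀ k →
      (∀ I → IsIndependentTok H k I → ∃ λ c → length I ≤ length (colourClass k c)) →
      IndependenceNumberTok H k (length (colourClass k true) ⊔ length (colourClass k false))
    independenceNumber≡max k bounded =
      largerClass ,
      λ I independent → let (c , I≤c) = bounded I independent in ≤-trans I≤c (class≤max c)
      where
      red  = length (colourClass k true)
      blue = length (colourClass k false)

      largerClass : ∃ λ I → IsIndependentTok H k I × length I ≡ red ⊔ blue
      largerClass with ≤-total red blue
      ... | inj₁ red≤blue =
        colourClass k false , colourClass-independent k false , sym (m≤n⇒m⊔n≡n red≤blue)
      ... | inj₂ blue≤red =
        colourClass k true  , colourClass-independent k true  , sym (m≥n⇒m⊔n≡m blue≤red)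

      class≤max : ∀ c → length (colourClass k c) ≤ red ⊔ blue
      class≤max true  = m≤m⊔n red blue
      class≤max false = m≤n⊔m red blue

    splitPair⇒colour-switch : ∀ {M} → All (λ e → Edge H (proj₁ e) (proj₂ e)) M →
      ∀ p {u v} → splitPair M p ≡ just (u , v) → colour (switch M p) ≡ not (colour p)
    splitPair⇒colour-switch {M} edges p {u} {v} eq = begin
      colour (switch M p)              ≡⟨ cong colour (switch-just M p eq) ⟩
      colour (p ⊕ ⁅ u ⁆∪⁅ v ⁆)          ≡⟨ colour-⊕ p ⁅ u ⁆∪⁅ v ⁆ ⟩
      colour p xor colour ⁅ u ⁆∪⁅ v ⁆   ≡⟨ cong (colour p xor_) (colour-⁅u⁆∪⁅v⁆ (edge⇒≢ H uv) (crossing uv)) ⟩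
      colour p xor true                ≡⟨ xor-trueʳ (colour p) ⟩
      not (colour p)                   ∎
      where open ≡-Reasoning
            uv = All.lookup edges (proj₁ (splitPair-sound M p eq))

    module _ (P : NearPerfectMatching H) where
      open NearPerfectMatching P

      unmatchedVertices : List (Fin n)
      unmatchedVertices = fromMaybe unmatched

      pairsInside : Subset n → ℕ
      pairsInside p = countIn (map proj₁ pairs) p

      countIn-vertices : ∀ p → countIn unmatchedVertices p + countIn (endpoints pairs) p ≡ ∣ p ∣
      countIn-vertices p = trans (sym (countIn-++ unmatchedVertices (endpoints pairs) p))
                                 (countIn-complete p vertices-unique vertices-complete)

      ∣p∣-unsplit : ∀ {p} → Unsplit pairs p →
        ∣ p ∣ ≡ countIn unmatchedVertices p + (pairsInside p + pairsInside p)
      ∣p∣-unsplit {p} unsplit = trans (sym (countIn-vertices p))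
        (cong (countIn unmatchedVertices p +_) (countIn-endpoints pairs p unsplit))

      ∣R∩p∣-unsplit : ∀ {p} → Unsplit pairs p → ∣ R ∩ p ∣ ≡ countIn unmatchedVertices (R ∩ p) + pairsInside p
      ∣R∩p∣-unsplit {p} unsplit = trans (sym (countIn-vertices (R ∩ p)))
        (cong (countIn unmatchedVertices (R ∩ p) +_)
              (countIn-endpoints-∩ pairs p (All.map crossing pairs⊆edges) unsplit))

      isOddᵇ-∣p∣-unsplit : ∀ {p} → Unsplit pairs p → isOddᵇ ∣ p ∣ ≡ isOddᵇ (countIn unmatchedVertices p)
      isOddᵇ-∣p∣-unsplit {p} unsplit = trans (cong isOddᵇ (∣p∣-unsplit unsplit))
        (isOddᵇ-+-double (countIn unmatchedVertices p) (pairsInside p))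

      unsplit-∣R∩∣ : ∀ {p q} → Unsplit pairs p → Unsplit pairs q → ∣ p ∣ ≡ ∣ q ∣ → ∣ R ∩ p ∣ ≡ ∣ R ∩ q ∣
      unsplit-∣R∩∣ {p} {q} up uq ∣p∣≡∣q∣ = begin
        ∣ R ∩ p ∣                                          ≡⟨ ∣R∩p∣-unsplit up ⟩
        countIn unmatchedVertices (R ∩ p) + pairsInside p
          ≡⟨ cong₂ _+_ (countIn-cong (AgreeOn-∩ˡ R agree)) samePairsInside ⟩
        countIn unmatchedVertices (R ∩ q) + pairsInside q  ≡⟨ ∣R∩p∣-unsplit uq ⟨
        ∣ R ∩ q ∣                                          ∎
        where
        open ≡-Reasoning
        agree : AgreeOn unmatchedVertices p q
        agree = AgreeOn-fromMaybe unmatched (begin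
          isOddᵇ (countIn unmatchedVertices p) ≡⟨ isOddᵇ-∣p∣-unsplit up ⟨
          isOddᵇ ∣ p ∣                         ≡⟨ cong isOddᵇ ∣p∣≡∣q∣ ⟩
          isOddᵇ ∣ q ∣                         ≡⟨ isOddᵇ-∣p∣-unsplit uq ⟩
          isOddᵇ (countIn unmatchedVertices q) ∎)
        samePairsInside : pairsInside p ≡ pairsInside q
        samePairsInside = double-injective (+-cancelˡ-≡ (countIn unmatchedVertices p) _ _ (begin
          countIn unmatchedVertices p + (pairsInside p + pairsInside p) ≡⟨ ∣p∣-unsplit up ⟨
          ∣ p ∣                                                         ≡⟨ ∣p∣≡∣q∣ ⟩
          ∣ q ∣                                                         ≡⟨ ∣p∣-unsplit uq ⟩
          countIn unmatchedVertices q + (pairsInside q + pairsInside q) ≡⟨ cong (_+ _) (countIn-cong agree) ⟨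
          countIn unmatchedVertices p + (pairsInside q + pairsInside q) ∎))

      module _ (k : ℕ) where

        -- When no unsplit k-set exists, any colour (here false) will do.
        unsplitColour-constant : ∃ λ c → ∀ {p} → Unsplit pairs p → ∣ p ∣ ≡ k → colour p ≡ c
        unsplitColour-constant with anySubset? (λ p → Unsplit? pairs p ×-dec (∣ p ∣ ≟ℕ k))
        ... | yes (q , uq , ∣q∣≡k) =
          colour q , λ up ∣p∣≡k → cong isOddᵇ (unsplit-∣R∩∣ up uq (trans ∣p∣≡k (sym ∣q∣≡k)))
        ... | no  none =
          false , λ {p} up ∣p∣≡k → ⊥-elim (none (p , up , ∣p∣≡k))

        unsplitColour : Bool
        unsplitColour = proj₁ unsplitColour-constant

        recolour : Subset n → Subset n
        recolour p = if colour p xor unsplitColour then switch pairs p else p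

        offColour⇒split : ∀ {p} → ∣ p ∣ ≡ k → colour p xor unsplitColour ≡ true →
          ∃ λ e → splitPair pairs p ≡ just e
        offColour⇒split {p} ∣p∣≡k off with splitPair pairs p in eq
        ... | just e  = e , refl
        ... | nothing = ⊥-elim (true≢false (begin
          true                             ≡⟨ off ⟨
          colour p xor unsplitColour       ≡⟨ cong (_xor unsplitColour) onColour ⟩
          unsplitColour xor unsplitColour  ≡⟨ xor-same unsplitColour ⟩
          false                            ∎))
          where open ≡-Reasoning
                onColour : colour p ≡ unsplitColour
                onColour = proj₂ unsplitColour-constant (splitPair≡nothing⇒Unsplit pairs p eq) ∣p∣≡k

        offColour⇒adjacent : ∀ {p} → ∣ p ∣ ≡ k → colour p xor unsplitColour ≡ true →
          TokenAdj H p (switch pairs p)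
        offColour⇒adjacent {p} ∣p∣≡k off =
          splitPair⇒adjacent H pairs⊆edges p (proj₂ (offColour⇒split ∣p∣≡k off))

        recolour-∈-colourClass : ∀ {p} → ∣ p ∣ ≡ k → recolour p ∈ colourClass k unsplitColour
        recolour-∈-colourClass {p} ∣p∣≡k with colour p xor unsplitColour in off
        ... | false = ∈-colourClass⁺ k {unsplitColour} ∣p∣≡k (xor≡false⇒≡ off)
        ... | true  = let (_ , split) = offColour⇒split ∣p∣≡k off in
          ∈-colourClass⁺ k {unsplitColour} (trans (splitPair⇒∣switch∣ H pairs⊆edges p split) ∣p∣≡k)
                           (trans (splitPair⇒colour-switch pairs⊆edges p split) (xor≡true⇒not≡ off))

        recolour-injectiveOn : ∀ {I} → IsIndependentTok H k I →
          ∀ {p q} → p ∈ I → q ∈ I → recolour p ≡ recolour q → p ≡ q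
        recolour-injectiveOn (_ , sizes , independent) {p} {q} p∈ q∈ eq
          with colour p xor unsplitColour in offp | colour q xor unsplitColour in offq
        ... | false | false = eq
        ... | false | true  = ⊥-elim (independent q∈ p∈
          (subst (TokenAdj H q) (sym eq) (offColour⇒adjacent (All.lookup sizes q∈) offq)))
        ... | true  | false = ⊥-elim (independent p∈ q∈
          (subst (TokenAdj H p) eq (offColour⇒adjacent (All.lookup sizes p∈) offp)))
        ... | true  | true  = begin
          p                              ≡⟨ switch-involutive pairs p endpoints-unique ⟨
          switch pairs (switch pairs p)  ≡⟨ cong (switch pairs) eq ⟩
          switch pairs (switch pairs q)  ≡⟨ switch-involutive pairs q endpoints-unique ⟩
          q                              ∎
          where open ≡-Reasoning

        independent≤colourClass : ∀ I → IsIndependentTok H k I →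
          ∃ λ c → length I ≤ length (colourClass k c)
        independent≤colourClass I independent@(unique , sizes , _) = unsplitColour ,
          injectiveOn⇒length≤ recolour unique (recolour-injectiveOn independent)
            (λ p∈ → recolour-∈-colourClass (All.lookup sizes p∈))

open Colouring using (independenceNumber≡max; independent≤colourClass)

theorem3p10 : (m n k : ℕ) → 1 ≤ m → 1 ≤ n → m ≤ n → 1 ≤ k → k + 1 ≤ m + n →
    (G G' : Graph (m + n)) → IsBipartiteWith m G → IsBipartiteWith m G' → G ⊑ G' →
    (HasPerfectMatching G ⊎ HasAlmostPerfectMatching G) →
    IndependenceNumberTok G' k (countRed m (m + n) k ⊔ countBlue m (m + n) k)
-- Only G' has to be bipartite, since a matching of G is one of G'.
theorem3p10 m n k _ _ _ _ _ G G' _ bipartite G⊑G' matching =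
  independenceNumber≡max (Rset m) G' crossing k
    (independent≤colourClass (Rset m) G' crossing matchingOfG' k)
  where
  crossing : ∀ {u v} → Edge G' u v → Colouring.Crossing (Rset m) u v
  crossing = bipartite⇒xor-Rset {H = G'} bipartite
  matchingOfG' : NearPerfectMatching G'
  matchingOfG' = NearPerfectMatching-mono G⊑G'
    ([ perfect⇒nearPerfect {H = G} , almostPerfect⇒nearPerfect ]′ matching)
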